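{- Let $G$ be a cubic graph and let $C_0 \subseteq G$ be a $2$-regular subgraph. Then $G$ has a $5$-cycle double cover which contains $C_0$ if and only if both of the following hold: (1) $G$ contains a matching $M$ such that $G - M$ (the graph obtained from $G$ by deleting the edges of $M$) has a nowhere-zero $4$-flow, and (2) $G$ contains two $2$-regular subgraphs $C_1, C_2$ with $M = E(C_1) \cap E(C_2)$ and $C_0 \subseteq C_1$.
   Context: A $2$-regular subgraph of a graph is a subgraph in which every vertex has degree exactly $2$ (i.e. a vertex-disjoint union of circuits, where a circuit is a $2$-connected $2$-regular graph). A cycle double cover (CDC) of a graph $G$ with maximum degree at most $3$ is a set $\mathbf{S}$ of $2$-regular subgraphs of $G$ such that every edge of $G$ is contained in exactly two elements of $\mathbf{S}$; if $|\mathbf{S}| = k$ it is called a $k$-CDC (here, a $5$-cycle double cover means a $5$-CDC). A $2$-regular subgraph $C_0$ of $G$ is said to be contained in a CDC $\mathbf{S}$ if $C_0$ is a subgraph of one of the elements of $\mathbf{S}$. -}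

module Defs where

open import Data.Nat using (ℕ; zero; suc; _+_; _<_)
open import Data.Integer as ℤ using (ℤ; ∣_∣)
open import Data.Fin using (Fin; zero; suc; _≟_)
open import Data.Bool using (Bool; true; false; _∧_; _∨_; if_then_else_; not)
open import Data.Product using (Σ; _×_; _,_; ∃; ∃-syntax)
open import Data.Sum using (_⊎_)
open import Relation.Nullary using (¬_)
open import Relation.Nullary.Decidable using (isYes)
open import Relation.Binary.PropositionalEquality using (_≡_; _≢_)
open import Function.Bundles using (_⇔_)

sumℕ : {m : ℕ} → (Fin m → ℕ) → ℕ
sumℕ {zero}  f = 0
sumℕ {suc m} f = f zero + sumℕ (λ i → f (suc i))

sumℤ : {m : ℕ} → (Fin m → ℤ) → ℤ
sumℤ {zero}  f = ℤ.0ℤ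
sumℤ {suc m} f = f zero ℤ.+ sumℤ (λ i → f (suc i))

count : {m : ℕ} → (Fin m → Bool) → ℕ
count p = sumℕ (λ i → if p i then 1 else 0)

-- A finite loopless multigraph: vertices Fin n, edges Fin m, each edge e
-- joins tail e and head e (the tail/head orientation is an arbitrary
-- reference orientation, used only to state flow conservation).
record Graph : Set where
  field
    n        : ℕ
    m        : ℕ
    tail     : Fin m → Fin n
    head     : Fin m → Fin n
    loopless : (e : Fin m) → tail e ≢ head e

module _ (G : Graph) where
  open Graph G

  -- Edge sets (spanning subgraphs are identified with their edge sets).
  EdgeSet : Set
  EdgeSet = Fin m → Bool

  incident : Fin m → Fin n → Bool
  incident e v = isYes (tail e ≟ v) ∨ isYes (head e ≟ v)

  degIn : EdgeSet → Fin n → ℕ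
  degIn S v = count (λ e → S e ∧ incident e v)

  Cubic : Set
  Cubic = (v : Fin n) → degIn (λ _ → true) v ≡ 3

  TwoRegular : EdgeSet → Set
  TwoRegular S = (v : Fin n) → (degIn S v ≡ 0) ⊎ (degIn S v ≡ 2)

  _⊆E_ : EdgeSet → EdgeSet → Set
  S ⊆E T = (e : Fin m) → S e ≡ true → T e ≡ true

  Matching : EdgeSet → Set
  Matching M = (v : Fin n) → degIn M v < 2

  outflow : EdgeSet → (Fin m → ℤ) → Fin n → ℤ
  outflow M f v = sumℤ (λ e → if not (M e) ∧ isYes (tail e ≟ v) then f e else ℤ.0ℤ)

  inflow : EdgeSet → (Fin m → ℤ) → Fin n → ℤ
  inflow M f v = sumℤ (λ e → if not (M e) ∧ isYes (head e ≟ v) then f e else ℤ.0ℤ)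

  IsNZ4FlowOfDeletion : EdgeSet → (Fin m → ℤ) → Set
  IsNZ4FlowOfDeletion M f =
    ((e : Fin m) → M e ≡ false → (0 < ∣ f e ∣) × (∣ f e ∣ < 4))
    × ((v : Fin n) → outflow M f v ≡ inflow M f v)

  HasNZ4FlowAfterDeleting : EdgeSet → Set
  HasNZ4FlowAfterDeleting M = ∃[ f ] IsNZ4FlowOfDeletion M f

  Is5CDC : (Fin 5 → EdgeSet) → Set
  Is5CDC F = ((i : Fin 5) → TwoRegular (F i))
           × ((e : Fin m) → count (λ i → F i e) ≡ 2)

  ContainedIn : EdgeSet → (Fin 5 → EdgeSet) → Set
  ContainedIn C0 F = ∃[ i ] (C0 ⊆E F i)

  Has5CDCContaining : EdgeSet → Set
  Has5CDCContaining C0 = ∃[ F ] (Is5CDC F × ContainedIn C0 F)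

  MatchingCondition : EdgeSet → Set
  MatchingCondition C0 =
    ∃[ M ] ( Matching M
           × HasNZ4FlowAfterDeleting M
           × ∃[ C1 ] ∃[ C2 ] ( TwoRegular C1 × TwoRegular C2
                              × ((e : Fin m) → M e ≡ (C1 e ∧ C2 e))
                              × (C0 ⊆E C1)))

module Submission where

open import Defs
open import Algebra.Properties.CommutativeMonoid.Sum as CommutativeMonoidSum using ()
open import Algebra.Properties.Semiring.Sum as SemiringSum using ()
open import Data.Bool as B using (Bool; true; false; _∧_; _∨_; not; _xor_; if_then_else_)
import Data.Bool.Properties as BP
open import Data.Empty using (⊥-elim)
open import Data.Fin using (Fin; zero; suc; _≟_)
open import Data.Fin.Patterns using (0F; 1F; 2F; 3F; 4F)
open import Data.Fin.Permutation using (Permutation; _⟨$⟩ʳ_; transpose)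
open import Data.Fin.Properties using (any?)
open import Data.Integer as ℤ using (ℤ; -[1+_]; 0ℤ; 1ℤ; -1ℤ; _⊖_)
import Data.Integer.Properties as ℤP
open import Data.Nat as ℕ using (ℕ; zero; suc; _+_; _≤_; _<_; z≤n; s≤s; parity; ⌊_/2⌋)
import Data.Nat.Properties as ℕP
open import Data.Parity as ℙ using (Parity; 0ℙ; 1ℙ)
import Data.Parity.Properties as ℙP
open import Data.Product using (_×_; _,_; proj₁; proj₂; ∃; ∃-syntax)
open import Data.Sum using (_⊎_; inj₁; inj₂)
open import Function using (_∘_)
open import Function.Bundles using (_⇔_; mk⇔)
open import Relation.Binary.PropositionalEquality
open import Relation.Nullary using (¬_; Dec; yes; no; ¬?; _×-dec_)
open import Relation.Nullary.Decidable using (isYes; does; dec-true; dec-false; decidable-stable)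

-- Both conditions amount to a pair of even subgraphs D₁, D₂ avoiding M with D₁ ∪ D₂ = E − M.
-- From a 5-CDC C₁, …, C₅ with C0 ⊆ C₁ and M = C₁ ∩ C₂ take D₁ = C₃ ⊕ C₄ and D₂ = C₄ ⊕ C₅; conversely,
-- with X = C₁ ⊕ C₂ the subgraphs C₁, C₂, D₁ ⊕ X, D₂ ⊕ X, D₁ ⊕ D₂ ⊕ X cover every edge exactly twice.
-- M is a matching: at a vertex the five degrees are 0 or 2 and add up to 2·3, while two edges of M
-- there would make C₃, C₄, C₅ avoid the vertex.
-- Such a pair is a nowhere-zero 4-flow of G − M in disguise. In a cubic graph an even subgraph is
-- 2-regular and carries a ±1-flow (orient its circuits), and φ₁ + 2φ₂ is nowhere zero off M.
-- Conversely the odd edges of a 4-flow f form D₁; if φ₁ is a ±1-flow on D₁ then (f − φ₁)/2 is a flow,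
-- and its odd edges D₂ contain the edges where f = ±2.
-- Circuits are oriented edge by edge: deleting edges leaves paths and circuits, which are oriented so
-- that the netflow is ±1 at the ends of the paths and 0 elsewhere.

module ℕΣ = CommutativeMonoidSum ℕP.+-0-commutativeMonoid
module ℤΣ = SemiringSum ℤP.+-*-semiring
module ℙΣ = CommutativeMonoidSum ℙP.+-0-commutativeMonoid

private variable k : ℕ

bit : Bool → ℕ
bit b = if b then 1 else 0

sumℕ≡sum : (f : Fin k → ℕ) → sumℕ f ≡ ℕΣ.sum f
sumℕ≡sum {zero}  f = refl
sumℕ≡sum {suc k} f = cong (_+_ (f zero)) (sumℕ≡sum (λ i → f (suc i)))

sumℤ≡sum : (f : Fin k → ℤ) → sumℤ f ≡ ℤΣ.sum f
sumℤ≡sum {zero}  f = refl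
sumℤ≡sum {suc k} f = cong (ℤ._+_ (f zero)) (sumℤ≡sum (λ i → f (suc i)))

sumℕ-cong : {f g : Fin k → ℕ} → (∀ i → f i ≡ g i) → sumℕ f ≡ sumℕ g
sumℕ-cong {zero}  f≗g = refl
sumℕ-cong {suc k} f≗g = cong₂ _+_ (f≗g zero) (sumℕ-cong (λ i → f≗g (suc i)))

sumℤ-cong : {f g : Fin k → ℤ} → (∀ i → f i ≡ g i) → sumℤ f ≡ sumℤ g
sumℤ-cong {zero}  f≗g = refl
sumℤ-cong {suc k} f≗g = cong₂ ℤ._+_ (f≗g zero) (sumℤ-cong (λ i → f≗g (suc i)))

sumℕ-distrib-+ : (f g : Fin k → ℕ) → sumℕ (λ i → f i + g i) ≡ sumℕ f + sumℕ g
sumℕ-distrib-+ f g = begin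
  sumℕ (λ i → f i + g i)     ≡⟨ sumℕ≡sum (λ i → f i + g i) ⟩
  ℕΣ.sum (λ i → f i + g i)   ≡⟨ ℕΣ.∑-distrib-+ f g ⟩
  ℕΣ.sum f + ℕΣ.sum g        ≡⟨ cong₂ _+_ (sumℕ≡sum f) (sumℕ≡sum g) ⟨
  sumℕ f + sumℕ g            ∎
  where open ≡-Reasoning

sumℕ-mono-≤ : {f g : Fin k → ℕ} → (∀ i → f i ≤ g i) → sumℕ f ≤ sumℕ g
sumℕ-mono-≤ {zero}  f≤g = z≤n
sumℕ-mono-≤ {suc k} f≤g = ℕP.+-mono-≤ (f≤g zero) (sumℕ-mono-≤ (λ i → f≤g (suc i)))

∧≡true : ∀ {a b} → a ∧ b ≡ true → a ≡ true × b ≡ true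
∧≡true {true} {true} _ = refl , refl

count≡0⇒false : (p : Fin k → Bool) → count p ≡ 0 → ∀ i → p i ≡ false
count≡0⇒false p eq zero    with p zero
... | false = refl
count≡0⇒false p eq (suc i) with p zero
... | false = count≡0⇒false (λ j → p (suc j)) eq i

count≢0⇒true : (p : Fin k → Bool) → count p ≢ 0 → ∃[ i ] p i ≡ true
count≢0⇒true {zero}  p ne = ⊥-elim (ne refl)
count≢0⇒true {suc k} p ne with p zero in eq
... | true  = zero , eq
... | false with count≢0⇒true (λ j → p (suc j)) ne
...   | i , pi = suc i , pi

remove : Fin k → (Fin k → Bool) → Fin k → Bool
remove i p j = if does (i ≟ j) then false else p j

count-remove : (p : Fin k → Bool) (i : Fin k) → p i ≡ true → count p ≡ suc (count (remove i p))
count-remove p zero    pi rewrite pi = refl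
count-remove p (suc i) pi with p zero
... | true  = cong suc (count-remove (λ j → p (suc j)) i pi)
... | false = count-remove (λ j → p (suc j)) i pi

δ : Fin k → Fin k → ℤ
δ i j = if does (i ≟ j) then 1ℤ else 0ℤ

sum-zero : {f : Fin k → ℤ} → (∀ i → f i ≡ 0ℤ) → ℤΣ.sum f ≡ 0ℤ
sum-zero {k} f≗0 = trans (ℤΣ.sum-cong-≗ f≗0) (ℤΣ.sum-replicate-zero k)

sum-δ-* : (i : Fin k) (f : Fin k → ℤ) → ℤΣ.sum (λ j → δ i j ℤ.* f j) ≡ f i
sum-δ-* zero    f = trans (cong₂ ℤ._+_ (ℤP.*-identityˡ (f zero)) rest≡0) (ℤP.+-identityʳ (f zero))
  where
  rest≡0 : ℤΣ.sum (λ j → δ zero (suc j) ℤ.* f (suc j)) ≡ 0ℤ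
  rest≡0 = sum-zero {f = λ j → δ zero (suc j) ℤ.* f (suc j)} (λ _ → refl)
sum-δ-* (suc i) f = trans (ℤP.+-identityˡ _) (sum-δ-* i (λ j → f (suc j)))

sum-neg : (f : Fin k → ℤ) → ℤΣ.sum (λ i → ℤ.- f i) ≡ ℤ.- ℤΣ.sum f
sum-neg f = begin
  ℤΣ.sum (λ i → ℤ.- f i)     ≡⟨ ℤΣ.sum-cong-≗ (λ i → ℤP.-1*i≡-i (f i)) ⟨
  ℤΣ.sum (λ i → -1ℤ ℤ.* f i) ≡⟨ ℤΣ.*-distribˡ-sum -1ℤ f ⟨
  -1ℤ ℤ.* ℤΣ.sum f           ≡⟨ ℤP.-1*i≡-i _ ⟩
  ℤ.- ℤΣ.sum f               ∎
  where open ≡-Reasoning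

sum-δ : (i : Fin k) → ℤΣ.sum (δ i) ≡ 1ℤ
sum-δ i = trans (ℤΣ.sum-cong-≗ (λ j → sym (ℤP.*-identityʳ (δ i j)))) (sum-δ-* i (λ _ → 1ℤ))

sum-pair : {u v : Fin k} (h : Fin k → ℤ) → u ≢ v → (∀ w → w ≢ u → w ≢ v → h w ≡ 0ℤ) →
           ℤΣ.sum h ≡ h u ℤ.+ h v
sum-pair {u = u} {v} h u≢v h≡0 = begin
  ℤΣ.sum h                                              ≡⟨ ℤΣ.sum-cong-≗ split ⟩
  ℤΣ.sum (λ w → δ u w ℤ.* h u ℤ.+ δ v w ℤ.* h v)        ≡⟨ ℤΣ.∑-distrib-+ (λ w → δ u w ℤ.* h u) _ ⟩
  ℤΣ.sum (λ w → δ u w ℤ.* h u) ℤ.+ ℤΣ.sum (λ w → δ v w ℤ.* h v)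
                                                        ≡⟨ cong₂ ℤ._+_ (sum-δ-* u (λ _ → h u)) (sum-δ-* v (λ _ → h v)) ⟩
  h u ℤ.+ h v                                           ∎
  where
  open ≡-Reasoning
  split : ∀ w → h w ≡ δ u w ℤ.* h u ℤ.+ δ v w ℤ.* h v
  split w with u ≟ w | v ≟ w
  ... | yes refl | yes refl = ⊥-elim (u≢v refl)
  ... | yes refl | no _     = sym (trans (ℤP.+-identityʳ _) (ℤP.*-identityˡ (h w)))
  ... | no _     | yes refl = sym (trans (ℤP.+-identityˡ _) (ℤP.*-identityˡ (h w)))
  ... | no u≢w   | no v≢w   = h≡0 w (λ w≡u → u≢w (sym w≡u)) (λ w≡v → v≢w (sym w≡v))

count-∧ : (p : Fin k → Bool) (b : Bool) → count (λ j → p j ∧ b) ≡ (if b then count p else 0)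
count-∧         p true  = sumℕ-cong (λ j → cong bit (BP.∧-identityʳ (p j)))
count-∧ {zero}  p false = refl
count-∧ {suc k} p false rewrite BP.∧-zeroʳ (p zero) = count-∧ (λ j → p (suc j)) false

sumℕ-comm : ∀ {k l} (h : Fin k → Fin l → ℕ) →
            sumℕ (λ i → sumℕ (h i)) ≡ sumℕ (λ j → sumℕ (λ i → h i j))
sumℕ-comm h = begin
  sumℕ (λ i → sumℕ (h i))                 ≡⟨ sumℕ≡sum (λ i → sumℕ (h i)) ⟩
  ℕΣ.sum (λ i → sumℕ (h i))               ≡⟨ ℕΣ.sum-cong-≗ (λ i → sumℕ≡sum (h i)) ⟩
  ℕΣ.sum (λ i → ℕΣ.sum (h i))             ≡⟨ ℕΣ.∑-comm h ⟩
  ℕΣ.sum (λ j → ℕΣ.sum (λ i → h i j))     ≡⟨ ℕΣ.sum-cong-≗ (λ j → sumℕ≡sum (λ i → h i j)) ⟨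
  ℕΣ.sum (λ j → sumℕ (λ i → h i j))       ≡⟨ sumℕ≡sum (λ j → sumℕ (λ i → h i j)) ⟨
  sumℕ (λ j → sumℕ (λ i → h i j))         ∎
  where open ≡-Reasoning

count-permute : ∀ (p : Fin k → Bool) (π : Permutation k k) → count (λ j → p (π ⟨$⟩ʳ j)) ≡ count p
count-permute p π = begin
  count (λ j → p (π ⟨$⟩ʳ j))               ≡⟨ sumℕ≡sum (λ j → bit (p (π ⟨$⟩ʳ j))) ⟩
  ℕΣ.sum (λ j → bit (p (π ⟨$⟩ʳ j)))        ≡⟨ ℕΣ.∑-permute (λ j → bit (p j)) π ⟨
  ℕΣ.sum (λ j → bit (p j))                 ≡⟨ sumℕ≡sum (λ j → bit (p j)) ⟨
  count p                                  ∎
  where open ≡-Reasoning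

parityℤ : ℤ → Parity
parityℤ x = parity ℤ.∣ x ∣

isOdd : Parity → Bool
isOdd 0ℙ = false
isOdd 1ℙ = true

isOdd-injective : ∀ {p q} → isOdd p ≡ isOdd q → p ≡ q
isOdd-injective {0ℙ} {0ℙ} _ = refl
isOdd-injective {1ℙ} {1ℙ} _ = refl

parity-bit-isOdd : ∀ p → parity (bit (isOdd p)) ≡ p
parity-bit-isOdd 0ℙ = refl
parity-bit-isOdd 1ℙ = refl

parity-suc+suc : ∀ m n → parity (suc m) ℙ.+ parity (suc n) ≡ parity m ℙ.+ parity n
parity-suc+suc m n rewrite ℙP.+-homo-+ 1 m | ℙP.+-homo-+ 1 n with parity m | parity n
... | 0ℙ | 0ℙ = refl
... | 0ℙ | 1ℙ = refl
... | 1ℙ | 0ℙ = refl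
... | 1ℙ | 1ℙ = refl

parityℤ-⊖ : ∀ m n → parityℤ (m ⊖ n) ≡ parity m ℙ.+ parity n
parityℤ-⊖ m       zero    = sym (ℙP.+-identityʳ (parity m))
parityℤ-⊖ zero    (suc n) = refl
parityℤ-⊖ (suc m) (suc n) rewrite ℤP.[1+m]⊖[1+n]≡m⊖n m n =
  trans (parityℤ-⊖ m n) (sym (parity-suc+suc m n))

parityℤ-homo-+ : ∀ x y → parityℤ (x ℤ.+ y) ≡ parityℤ x ℙ.+ parityℤ y
parityℤ-homo-+ (ℤ.+ m)  (ℤ.+ n)    = ℙP.+-homo-+ m n
parityℤ-homo-+ (ℤ.+ m)  -[1+ n ] = parityℤ-⊖ m (suc n)
parityℤ-homo-+ -[1+ m ] (ℤ.+ n)   = trans (parityℤ-⊖ n (suc m)) (ℙP.+-comm (parity n) _)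
parityℤ-homo-+ -[1+ m ] -[1+ n ] =
  trans (cong (λ k → parity (suc k)) (sym (ℕP.+-suc m n))) (ℙP.+-homo-+ (suc m) (suc n))

parityℤ-neg : ∀ x → parityℤ (ℤ.- x) ≡ parityℤ x
parityℤ-neg x = cong parity (ℤP.∣-i∣≡∣i∣ x)

parityℤ-homo-− : ∀ x y → parityℤ (x ℤ.- y) ≡ parityℤ x ℙ.+ parityℤ y
parityℤ-homo-− x y = trans (parityℤ-homo-+ x (ℤ.- y)) (cong (parityℤ x ℙ.+_) (parityℤ-neg y))

parity-sumℕ : (f : Fin k → ℕ) → parity (sumℕ f) ≡ ℙΣ.sum (λ i → parity (f i))
parity-sumℕ {zero}  f = refl
parity-sumℕ {suc k} f =
  trans (ℙP.+-homo-+ (f zero) _) (cong (parity (f zero) ℙ.+_) (parity-sumℕ (λ i → f (suc i))))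

parityℤ-sum : (f : Fin k → ℤ) → parityℤ (ℤΣ.sum f) ≡ ℙΣ.sum (λ i → parityℤ (f i))
parityℤ-sum {zero}  f = refl
parityℤ-sum {suc k} f =
  trans (parityℤ-homo-+ (f zero) _) (cong (parityℤ (f zero) ℙ.+_) (parityℤ-sum (λ i → f (suc i))))

⌊suc/2⌋≡⌊/2⌋ : ∀ n → parity n ≡ 0ℙ → ⌊ suc n /2⌋ ≡ ⌊ n /2⌋
⌊suc/2⌋≡⌊/2⌋ 0             _    = refl
⌊suc/2⌋≡⌊/2⌋ (suc (suc n)) even = cong suc (⌊suc/2⌋≡⌊/2⌋ n even)

⌊/2⌋+⌊/2⌋ : ∀ n → parity n ≡ 0ℙ → ⌊ n /2⌋ + ⌊ n /2⌋ ≡ n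
⌊/2⌋+⌊/2⌋ n even =
  trans (cong (⌊ n /2⌋ +_) (sym (⌊suc/2⌋≡⌊/2⌋ n even))) (ℕP.⌊n/2⌋+⌈n/2⌉≡n n)

half : ℤ → ℤ
half (ℤ.+ n)  = ℤ.+ ⌊ n /2⌋
half -[1+ n ] = ℤ.- (ℤ.+ ⌊ suc n /2⌋)

half+half : ∀ x → parityℤ x ≡ 0ℙ → half x ℤ.+ half x ≡ x
half+half (ℤ.+ n)  even = cong ℤ.+_ (⌊/2⌋+⌊/2⌋ n even)
half+half -[1+ n ] even = trans (sym (ℤP.neg-distrib-+ (ℤ.+ ⌊ suc n /2⌋) _))
                                (cong (λ k → ℤ.- (ℤ.+ k)) (⌊/2⌋+⌊/2⌋ (suc n) even))

x+x≡0⇒x≡0 : ∀ x → x ℤ.+ x ≡ 0ℤ → x ≡ 0ℤ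
x+x≡0⇒x≡0 (ℤ.+ zero) _ = refl

-- Such an x is ±2.
half-odd : ∀ x → 0 < ℤ.∣ x ∣ → ℤ.∣ x ∣ < 4 → parityℤ x ≡ 0ℙ → parityℤ (half x) ≡ 1ℙ
half-odd (ℤ.+ 2)  _ _ _ = refl
half-odd -[1+ 1 ] _ _ _ = refl
half-odd (ℤ.+ 0)  () _ _
half-odd (ℤ.+ suc (suc (suc (suc _)))) _ (s≤s (s≤s (s≤s (s≤s ())))) _
half-odd -[1+ suc (suc (suc _)) ]      _ (s≤s (s≤s (s≤s (s≤s ())))) _

IsUnit : ℤ → Set
IsUnit x = x ≡ 1ℤ ⊎ x ≡ -1ℤ

IsUnit-* : ∀ {x y} → IsUnit x → IsUnit y → IsUnit (x ℤ.* y)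
IsUnit-* (inj₁ refl) (inj₁ refl) = inj₁ refl
IsUnit-* (inj₁ refl) (inj₂ refl) = inj₂ refl
IsUnit-* (inj₂ refl) (inj₁ refl) = inj₂ refl
IsUnit-* (inj₂ refl) (inj₂ refl) = inj₁ refl

parityℤ-unit : ∀ {x} → IsUnit x → parityℤ x ≡ 1ℙ
parityℤ-unit (inj₁ refl) = refl
parityℤ-unit (inj₂ refl) = refl

-- The sign s closing a path at its tail end (a + s = 0) and/or at its head end (b − s = 0).
balancingSign : ∀ {P Q : Set} → Dec P → Dec Q → (a b : ℤ) → (P → IsUnit a) → (Q → IsUnit b) →
                (P → Q → a ℤ.+ b ≡ 0ℤ) →
                ∃[ s ] IsUnit s × (P → a ℤ.+ 1ℤ ℤ.* s ≡ 0ℤ) × (Q → b ℤ.+ -1ℤ ℤ.* s ≡ 0ℤ)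
balancingSign (no ¬p) (no ¬q) a b _ _ _ =
  1ℤ , inj₁ refl , (λ p → ⊥-elim (¬p p)) , (λ q → ⊥-elim (¬q q))
balancingSign (yes p) (no ¬q) a b ua _ _ with ua p
... | inj₁ refl = -1ℤ , inj₂ refl , (λ _ → refl) , (λ q → ⊥-elim (¬q q))
... | inj₂ refl = 1ℤ , inj₁ refl , (λ _ → refl) , (λ q → ⊥-elim (¬q q))
balancingSign (no ¬p) (yes q) a b _ ub _ with ub q
... | inj₁ refl = 1ℤ , inj₁ refl , (λ p → ⊥-elim (¬p p)) , (λ _ → refl)
... | inj₂ refl = -1ℤ , inj₂ refl , (λ p → ⊥-elim (¬p p)) , (λ _ → refl)
balancingSign (yes p) (yes q) a b ua ub a+b≡0 with ua p | ub q | a+b≡0 p q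
... | inj₁ refl | inj₁ refl | ()
... | inj₁ refl | inj₂ refl | _ = -1ℤ , inj₂ refl , (λ _ → refl) , (λ _ → refl)
... | inj₂ refl | inj₁ refl | _ = 1ℤ , inj₁ refl , (λ _ → refl) , (λ _ → refl)
... | inj₂ refl | inj₂ refl | ()

-- `count` over Fin 5 unfolds to this.
count5 : Bool → Bool → Bool → Bool → Bool → ℕ
count5 a b c d e = bit a + (bit b + (bit c + (bit d + (bit e + 0))))

doubly-covered-outside : ∀ a b c d e → count5 a b c d e ≡ 2 → a ∧ b ≡ true →
                         c ≡ false × d ≡ false × e ≡ false
doubly-covered-outside true  true  false false false _ _ = refl , refl , refl
doubly-covered-outside true  true  true  _     _     () _
doubly-covered-outside true  true  false true  _     () _
doubly-covered-outside true  true  false false true  () _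

differences-cover : ∀ a b c d e → count5 a b c d e ≡ 2 → a ∧ b ≡ false → (c xor d) ∨ (d xor e) ≡ true
differences-cover _     _     true  true  false _ _ = refl
differences-cover _     _     true  false _     _ _ = refl
differences-cover _     _     false true  _     _ _ = refl
differences-cover _     _     false false true  _ _ = refl
differences-cover true  true  true  true  true  () _
differences-cover true  false true  true  true  () _
differences-cover false true  true  true  true  () _
differences-cover false false true  true  true  () _
differences-cover true  true  false false false _ ()
differences-cover true  false false false false () _
differences-cover false true  false false false () _
differences-cover false false false false false () _

five-cover : ∀ c₁ c₂ d₁ d₂ → (c₁ ∧ c₂ ≡ true → d₁ ≡ false × d₂ ≡ false) →
  (c₁ ∧ c₂ ≡ false → d₁ ∨ d₂ ≡ true) →
  count5 c₁ c₂ (d₁ xor (c₁ xor c₂)) (d₂ xor (c₁ xor c₂)) ((d₁ xor d₂) xor (c₁ xor c₂)) ≡ 2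
five-cover true  true  d₁    d₂    onM _ with onM refl
... | refl , refl = refl
five-cover true  false true  true  _ _ = refl
five-cover true  false true  false _ _ = refl
five-cover true  false false true  _ _ = refl
five-cover false true  true  true  _ _ = refl
five-cover false true  true  false _ _ = refl
five-cover false true  false true  _ _ = refl
five-cover false false true  true  _ _ = refl
five-cover false false true  false _ _ = refl
five-cover false false false true  _ _ = refl
five-cover true  false false false _ offM with () ← offM refl
five-cover false true  false false _ offM with () ← offM refl
five-cover false false false false _ offM with () ← offM refl

x+2y-nowhere-zero : ∀ {x y} d₁ d₂ → (d₁ ≡ true → IsUnit x) → (d₁ ≡ false → x ≡ 0ℤ) →
                    (d₂ ≡ true → IsUnit y) → (d₂ ≡ false → y ≡ 0ℤ) → d₁ ∨ d₂ ≡ true →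
                    0 < ℤ.∣ x ℤ.+ (y ℤ.+ y) ∣ × ℤ.∣ x ℤ.+ (y ℤ.+ y) ∣ < 4
x+2y-nowhere-zero true  true  ux _ uy _ _ with ux refl | uy refl
... | inj₁ refl | inj₁ refl = ℕP.<ᵇ⇒< _ _ _ , ℕP.<ᵇ⇒< _ _ _
... | inj₁ refl | inj₂ refl = ℕP.<ᵇ⇒< _ _ _ , ℕP.<ᵇ⇒< _ _ _
... | inj₂ refl | inj₁ refl = ℕP.<ᵇ⇒< _ _ _ , ℕP.<ᵇ⇒< _ _ _
... | inj₂ refl | inj₂ refl = ℕP.<ᵇ⇒< _ _ _ , ℕP.<ᵇ⇒< _ _ _
x+2y-nowhere-zero true  false ux _ _ zy _ with ux refl | zy refl
... | inj₁ refl | refl = ℕP.<ᵇ⇒< _ _ _ , ℕP.<ᵇ⇒< _ _ _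
... | inj₂ refl | refl = ℕP.<ᵇ⇒< _ _ _ , ℕP.<ᵇ⇒< _ _ _
x+2y-nowhere-zero false true  _ zx uy _ _ with zx refl | uy refl
... | refl | inj₁ refl = ℕP.<ᵇ⇒< _ _ _ , ℕP.<ᵇ⇒< _ _ _
... | refl | inj₂ refl = ℕP.<ᵇ⇒< _ _ _ , ℕP.<ᵇ⇒< _ _ _

-- If x ≥ 2 then d₃ = d₄ = d₅ = 0, and d₁ + d₂ ≤ 4 < 6.
matching-degree : ∀ {d₁ d₂ d₃ d₄ d₅ x} → (d₁ ≡ 0 ⊎ d₁ ≡ 2) → (d₂ ≡ 0 ⊎ d₂ ≡ 2) →
  (d₃ ≡ 0 ⊎ d₃ ≡ 2) → (d₄ ≡ 0 ⊎ d₄ ≡ 2) → (d₅ ≡ 0 ⊎ d₅ ≡ 2) →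
  d₁ + (d₂ + (d₃ + (d₄ + (d₅ + 0)))) ≡ 3 + 3 →
  d₃ + x ≤ 3 → d₄ + x ≤ 3 → d₅ + x ≤ 3 → x < 2
matching-degree _ _ (inj₂ refl) _ _ _ (s≤s (s≤s x≤1)) _ _ = s≤s x≤1
matching-degree _ _ (inj₁ refl) (inj₂ refl) _ _ _ (s≤s (s≤s x≤1)) _ = s≤s x≤1
matching-degree _ _ (inj₁ refl) (inj₁ refl) (inj₂ refl) _ _ _ (s≤s (s≤s x≤1)) = s≤s x≤1
matching-degree (inj₁ refl) (inj₁ refl) (inj₁ refl) (inj₁ refl) (inj₁ refl) () _ _ _
matching-degree (inj₁ refl) (inj₂ refl) (inj₁ refl) (inj₁ refl) (inj₁ refl) () _ _ _
matching-degree (inj₂ refl) (inj₁ refl) (inj₁ refl) (inj₁ refl) (inj₁ refl) () _ _ _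
matching-degree (inj₂ refl) (inj₂ refl) (inj₁ refl) (inj₁ refl) (inj₁ refl) () _ _ _

module _ (G : Graph) where
  open Graph G

  deg : EdgeSet G → Fin n → ℕ
  deg = degIn G

  incidence : Fin n → Fin m → ℤ
  incidence v e = δ (tail e) v ℤ.- δ (head e) v

  netflow : (Fin m → ℤ) → Fin n → ℤ
  netflow φ v = ℤΣ.sum (λ e → incidence v e ℤ.* φ e)

  IsFlow : (Fin m → ℤ) → Set
  IsFlow φ = ∀ v → netflow φ v ≡ 0ℤ

  incident-tail : ∀ e → incident G e (tail e) ≡ true
  incident-tail e with tail e ≟ tail e
  ... | yes _   = refl
  ... | no t≢t = ⊥-elim (t≢t refl)

  incident-head : ∀ e → incident G e (head e) ≡ true
  incident-head e with head e ≟ head e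
  ... | yes _   = BP.∨-zeroʳ _
  ... | no h≢h = ⊥-elim (h≢h refl)

  incident⇒endpoint : ∀ {e w} → incident G e w ≡ true → tail e ≡ w ⊎ head e ≡ w
  incident⇒endpoint {e} {w} _ with tail e ≟ w | head e ≟ w
  ... | yes t≡w | _       = inj₁ t≡w
  ... | no _    | yes h≡w = inj₂ h≡w

  nonendpoint⇒nonincident : ∀ {e w} → w ≢ tail e → w ≢ head e → incident G e w ≡ false
  nonendpoint⇒nonincident {e} {w} w≢t w≢h with incident G e w in inc
  ... | false = refl
  ... | true with incident⇒endpoint inc
  ...   | inj₁ t≡w = ⊥-elim (w≢t (sym t≡w))
  ...   | inj₂ h≡w = ⊥-elim (w≢h (sym h≡w))

  incidence-tail : ∀ e → incidence (tail e) e ≡ 1ℤ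
  incidence-tail e rewrite dec-true (tail e ≟ tail e) refl
                         | dec-false (head e ≟ tail e) (λ h≡t → loopless e (sym h≡t)) = refl

  incidence-head : ∀ e → incidence (head e) e ≡ -1ℤ
  incidence-head e rewrite dec-true (head e ≟ head e) refl | dec-false (tail e ≟ head e) (loopless e) = refl

  incidence-unit : ∀ {e w} → incident G e w ≡ true → IsUnit (incidence w e)
  incidence-unit {e} inc with incident⇒endpoint inc
  ... | inj₁ refl = inj₁ (incidence-tail e)
  ... | inj₂ refl = inj₂ (incidence-head e)

  incidence-nonincident : ∀ {e w} → incident G e w ≡ false → incidence w e ≡ 0ℤ
  incidence-nonincident {e} {w} _ with tail e ≟ w | head e ≟ w
  incidence-nonincident () | yes _ | _
  incidence-nonincident () | no _  | yes _
  ... | no _ | no _ = refl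

  sum-incidence : ∀ e → ℤΣ.sum (λ v → incidence v e) ≡ 0ℤ
  sum-incidence e = begin
    ℤΣ.sum (λ v → δ (tail e) v ℤ.- δ (head e) v)             ≡⟨ ℤΣ.∑-distrib-+ (δ (tail e)) _ ⟩
    ℤΣ.sum (δ (tail e)) ℤ.+ ℤΣ.sum (λ v → ℤ.- δ (head e) v)
      ≡⟨ cong (ℤ._+_ (ℤΣ.sum (δ (tail e)))) (sum-neg (δ (head e))) ⟩
    ℤΣ.sum (δ (tail e)) ℤ.- ℤΣ.sum (δ (head e))              ≡⟨ cong₂ ℤ._-_ (sum-δ (tail e)) (sum-δ (head e)) ⟩
    1ℤ ℤ.- 1ℤ                                                ∎
    where open ≡-Reasoning

  netflow-total : ∀ φ → ℤΣ.sum (netflow φ) ≡ 0ℤ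
  netflow-total φ = begin
    ℤΣ.sum (λ v → ℤΣ.sum (λ e → incidence v e ℤ.* φ e))   ≡⟨ ℤΣ.∑-comm (λ v e → incidence v e ℤ.* φ e) ⟩
    ℤΣ.sum (λ e → ℤΣ.sum (λ v → incidence v e ℤ.* φ e))
      ≡⟨ ℤΣ.sum-cong-≗ (λ e → ℤΣ.*-distribʳ-sum (φ e) (λ v → incidence v e)) ⟨
    ℤΣ.sum (λ e → ℤΣ.sum (λ v → incidence v e) ℤ.* φ e)
      ≡⟨ sum-zero (λ e → cong (ℤ._* φ e) (sum-incidence e)) ⟩
    0ℤ                                                     ∎
    where open ≡-Reasoning

  netflow-+ : ∀ φ ψ v → netflow (λ e → φ e ℤ.+ ψ e) v ≡ netflow φ v ℤ.+ netflow ψ v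
  netflow-+ φ ψ v = trans (ℤΣ.sum-cong-≗ (λ e → ℤP.*-distribˡ-+ (incidence v e) (φ e) (ψ e)))
                          (ℤΣ.∑-distrib-+ (λ e → incidence v e ℤ.* φ e) _)

  netflow-δ : ∀ e s w → netflow (λ e' → δ e e' ℤ.* s) w ≡ incidence w e ℤ.* s
  netflow-δ e s w = begin
    ℤΣ.sum (λ e' → incidence w e' ℤ.* (δ e e' ℤ.* s))
      ≡⟨ ℤΣ.sum-cong-≗ (λ e' → ℤP.*-comm (incidence w e') _) ⟩
    ℤΣ.sum (λ e' → (δ e e' ℤ.* s) ℤ.* incidence w e')   ≡⟨ ℤΣ.sum-cong-≗ (λ e' → ℤP.*-assoc (δ e e') s _) ⟩
    ℤΣ.sum (λ e' → δ e e' ℤ.* (s ℤ.* incidence w e'))   ≡⟨ sum-δ-* e (λ e' → s ℤ.* incidence w e') ⟩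
    s ℤ.* incidence w e                                  ≡⟨ ℤP.*-comm s _ ⟩
    incidence w e ℤ.* s                                  ∎
    where open ≡-Reasoning

  Even : EdgeSet G → Set
  Even S = ∀ v → parity (deg S v) ≡ 0ℙ

  oddSupport : (Fin m → ℤ) → EdgeSet G
  oddSupport φ e = isOdd (parityℤ (φ e))

  parity-incidence-* : ∀ v e x →
    parityℤ (incidence v e ℤ.* x) ≡ parity (bit (oddSupport (λ _ → x) e ∧ incident G e v))
  parity-incidence-* v e x with tail e ≟ v | head e ≟ v
  ... | yes t≡v | yes h≡v = ⊥-elim (loopless e (trans t≡v (sym h≡v)))
  ... | yes _   | no _    rewrite ℤP.*-identityˡ x | BP.∧-identityʳ (isOdd (parityℤ x)) =
                            sym (parity-bit-isOdd _)
  ... | no _    | yes _   rewrite ℤP.-1*i≡-i x | BP.∧-identityʳ (isOdd (parityℤ x)) =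
                            trans (parityℤ-neg x) (sym (parity-bit-isOdd _))
  ... | no _    | no _    rewrite BP.∧-zeroʳ (isOdd (parityℤ x)) = refl

  flow⇒even-oddSupport : ∀ {φ} → IsFlow φ → Even (oddSupport φ)
  flow⇒even-oddSupport {φ} flow v = begin
    parity (deg (oddSupport φ) v)
      ≡⟨ parity-sumℕ (λ e → bit (oddSupport φ e ∧ incident G e v)) ⟩
    ℙΣ.sum (λ e → parity (bit (oddSupport φ e ∧ incident G e v)))
      ≡⟨ ℙΣ.sum-cong-≗ (λ e → parity-incidence-* v e (φ e)) ⟨
    ℙΣ.sum (λ e → parityℤ (incidence v e ℤ.* φ e))
      ≡⟨ parityℤ-sum (λ e → incidence v e ℤ.* φ e) ⟨
    parityℤ (netflow φ v)                                                     ≡⟨ cong parityℤ (flow v) ⟩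
    0ℙ                                                                        ∎
    where open ≡-Reasoning

  deg-xor : ∀ S T v → deg (λ e → S e xor T e) v + (deg (λ e → S e ∧ T e) v + deg (λ e → S e ∧ T e) v)
                      ≡ deg S v + deg T v
  deg-xor S T v = begin
    deg S⊕T v + (deg S∩T v + deg S∩T v)    ≡⟨ cong (deg S⊕T v +_) (sumℕ-distrib-+ (bitAt S∩T) (bitAt S∩T)) ⟨
    deg S⊕T v + sumℕ (λ e → bitAt S∩T e + bitAt S∩T e)
                                            ≡⟨ sumℕ-distrib-+ (bitAt S⊕T) _ ⟨
    sumℕ (λ e → bitAt S⊕T e + (bitAt S∩T e + bitAt S∩T e))
                                            ≡⟨ sumℕ-cong (λ e → pointwise (S e) (T e) (incident G e v)) ⟩
    sumℕ (λ e → bitAt S e + bitAt T e)      ≡⟨ sumℕ-distrib-+ (bitAt S) (bitAt T) ⟩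
    deg S v + deg T v                       ∎
    where
    open ≡-Reasoning
    S⊕T S∩T : EdgeSet G
    S⊕T e = S e xor T e
    S∩T e = S e ∧ T e
    bitAt : EdgeSet G → Fin m → ℕ
    bitAt X e = bit (X e ∧ incident G e v)
    pointwise : ∀ a b c →
      bit ((a xor b) ∧ c) + (bit ((a ∧ b) ∧ c) + bit ((a ∧ b) ∧ c)) ≡ bit (a ∧ c) + bit (b ∧ c)
    pointwise true  true  true  = refl
    pointwise true  false true  = refl
    pointwise false true  true  = refl
    pointwise false false true  = refl
    pointwise true  true  false = refl
    pointwise true  false false = refl
    pointwise false true  false = refl
    pointwise false false false = refl

  even-xor : ∀ {S T} → Even S → Even T → Even (λ e → S e xor T e)
  even-xor {S} {T} evenS evenT v = begin
    parity d⊕                                      ≡⟨ ℙP.+-identityʳ _ ⟨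
    parity d⊕ ℙ.+ 0ℙ                               ≡⟨ cong (parity d⊕ ℙ.+_) (ℙP.p+p≡0ℙ (parity d∩)) ⟨
    parity d⊕ ℙ.+ (parity d∩ ℙ.+ parity d∩)        ≡⟨ cong (parity d⊕ ℙ.+_) (ℙP.+-homo-+ d∩ d∩) ⟨
    parity d⊕ ℙ.+ parity (d∩ + d∩)                 ≡⟨ ℙP.+-homo-+ d⊕ _ ⟨
    parity (d⊕ + (d∩ + d∩))                        ≡⟨ cong parity (deg-xor S T v) ⟩
    parity (deg S v + deg T v)                     ≡⟨ ℙP.+-homo-+ (deg S v) _ ⟩
    parity (deg S v) ℙ.+ parity (deg T v)          ≡⟨ cong₂ ℙ._+_ (evenS v) (evenT v) ⟩
    0ℙ                                             ∎
    where
    open ≡-Reasoning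
    d⊕ d∩ : ℕ
    d⊕ = deg (λ e → S e xor T e) v
    d∩ = deg (λ e → S e ∧ T e) v

  deg-mono : ∀ {S T} → (∀ e → S e ≡ true → T e ≡ true) → ∀ v → deg S v ≤ deg T v
  deg-mono {S} {T} S⊆T v = sumℕ-mono-≤ pointwise
    where
    pointwise : ∀ e → bit (S e ∧ incident G e v) ≤ bit (T e ∧ incident G e v)
    pointwise e with S e in Se
    ... | false = z≤n
    ... | true rewrite S⊆T e Se = ℕP.≤-refl

  deg-remove : ∀ {S e w b} → S e ≡ true → incident G e w ≡ b → deg S w ≡ deg (remove e S) w + bit b
  deg-remove {S} {e} {w} Se refl with incident G e w in inc
  ... | true  = trans (count-remove (λ e' → S e' ∧ incident G e' w) e (cong₂ _∧_ Se inc))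
                      (trans (cong suc (sumℕ-cong removeAt)) (ℕP.+-comm 1 _))
    where
    removeAt : ∀ e' →
      bit (remove e (λ e'' → S e'' ∧ incident G e'' w) e') ≡ bit (remove e S e' ∧ incident G e' w)
    removeAt e' with e ≟ e'
    ... | yes _ = refl
    ... | no _  = refl
  ... | false = trans (sumℕ-cong unchanged) (sym (ℕP.+-identityʳ _))
    where
    unchanged : ∀ e' → bit (S e' ∧ incident G e' w) ≡ bit (remove e S e' ∧ incident G e' w)
    unchanged e' with e ≟ e'
    ... | yes refl rewrite inc = cong bit (BP.∧-zeroʳ (S e))
    ... | no _     = refl

  remove-⊆ : ∀ {S : EdgeSet G} {e} e' → remove e S e' ≡ true → S e' ≡ true
  remove-⊆ {e = e} e' with e ≟ e'
  ... | yes _ = λ ()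
  ... | no _  = λ Se' → Se'

  twoRegular⇒even : ∀ {S} → TwoRegular G S → Even S
  twoRegular⇒even {S} twoReg v with twoReg v
  ... | inj₁ d≡0 rewrite d≡0 = refl
  ... | inj₂ d≡2 rewrite d≡2 = refl

  even⇒twoRegular : Cubic G → ∀ {S} → Even S → TwoRegular G S
  even⇒twoRegular cubic {S} even v =
    lemma (deg S v) (subst (deg S v ≤_) (cubic v) (deg-mono (λ _ _ → refl) v)) (even v)
    where
    lemma : ∀ d → d ≤ 3 → parity d ≡ 0ℙ → (d ≡ 0) ⊎ (d ≡ 2)
    lemma 0 _ _ = inj₁ refl
    lemma 2 _ _ = inj₂ refl
    lemma 1 _ ()
    lemma 3 _ ()
    lemma (suc (suc (suc (suc _)))) (s≤s (s≤s (s≤s ()))) _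

  netflow-cong : ∀ {φ ψ} → (∀ e → φ e ≡ ψ e) → ∀ v → netflow φ v ≡ netflow ψ v
  netflow-cong φ≗ψ v = ℤΣ.sum-cong-≗ (λ e → cong (incidence v e ℤ.*_) (φ≗ψ e))

  netflow-neg : ∀ φ v → netflow (λ e → ℤ.- φ e) v ≡ ℤ.- netflow φ v
  netflow-neg φ v = trans (ℤΣ.sum-cong-≗ (λ e → sym (ℤP.neg-distribʳ-* (incidence v e) (φ e))))
                          (sum-neg (λ e → incidence v e ℤ.* φ e))

  netflow≡outflow−inflow : ∀ M f → (∀ e → M e ≡ true → f e ≡ 0ℤ) →
                           ∀ v → netflow f v ≡ outflow G M f v ℤ.- inflow G M f v
  netflow≡outflow−inflow M f f≡0 v = begin
    ℤΣ.sum (λ e → incidence v e ℤ.* f e)             ≡⟨ ℤΣ.sum-cong-≗ pointwise ⟩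
    ℤΣ.sum (λ e → out e ℤ.- in' e)                   ≡⟨ ℤΣ.∑-distrib-+ out _ ⟩
    ℤΣ.sum out ℤ.+ ℤΣ.sum (λ e → ℤ.- in' e)          ≡⟨ cong (ℤ._+_ (ℤΣ.sum out)) (sum-neg in') ⟩
    ℤΣ.sum out ℤ.- ℤΣ.sum in'                        ≡⟨ cong₂ ℤ._-_ (sumℤ≡sum out) (sumℤ≡sum in') ⟨
    outflow G M f v ℤ.- inflow G M f v               ∎
    where
    open ≡-Reasoning
    out in' : Fin m → ℤ
    out e = if not (M e) ∧ isYes (tail e ≟ v) then f e else 0ℤ
    in' e = if not (M e) ∧ isYes (head e ≟ v) then f e else 0ℤ
    pointwise : ∀ e → incidence v e ℤ.* f e ≡ out e ℤ.- in' e
    pointwise e with M e in Me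
    ... | true rewrite f≡0 e Me = ℤP.*-zeroʳ (incidence v e)
    ... | false with tail e ≟ v | head e ≟ v
    ...   | yes t≡v | yes h≡v = ⊥-elim (loopless e (trans t≡v (sym h≡v)))
    ...   | yes _   | no _    = trans (ℤP.*-identityˡ (f e)) (sym (ℤP.+-identityʳ (f e)))
    ...   | no _    | yes _   = trans (ℤP.-1*i≡-i (f e)) (sym (ℤP.+-identityˡ (ℤ.- f e)))
    ...   | no _    | no _    = refl

  restrict : EdgeSet G → (Fin m → ℤ) → Fin m → ℤ
  restrict M f e = if M e then 0ℤ else f e

  restrict-zero : ∀ M f e → M e ≡ true → restrict M f e ≡ 0ℤ
  restrict-zero M f e Me rewrite Me = refl

  restrict-off : ∀ M f e → M e ≡ false → restrict M f e ≡ f e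
  restrict-off M f e Me rewrite Me = refl

  kirchhoff⇒flow : ∀ M f → (∀ v → outflow G M f v ≡ inflow G M f v) → IsFlow (restrict M f)
  kirchhoff⇒flow M f kirchhoff v = begin
    netflow (restrict M f) v
      ≡⟨ netflow≡outflow−inflow M _ (restrict-zero M f) v ⟩
    outflow G M (restrict M f) v ℤ.- inflow G M (restrict M f) v
      ≡⟨ cong₂ ℤ._-_ (sumℤ-cong-restrict tail) (sumℤ-cong-restrict head) ⟩
    outflow G M f v ℤ.- inflow G M f v
      ≡⟨ cong (ℤ._-_ (outflow G M f v)) (kirchhoff v) ⟨
    outflow G M f v ℤ.- outflow G M f v                                ≡⟨ ℤP.+-inverseʳ (outflow G M f v) ⟩
    0ℤ                                                                 ∎
    where
    open ≡-Reasoning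
    sumℤ-cong-restrict : ∀ end →
                         sumℤ (λ e → if not (M e) ∧ isYes (end e ≟ v) then restrict M f e else 0ℤ)
                         ≡ sumℤ (λ e → if not (M e) ∧ isYes (end e ≟ v) then f e else 0ℤ)
    sumℤ-cong-restrict end = sumℤ-cong pointwise
      where
      pointwise : ∀ e → (if not (M e) ∧ isYes (end e ≟ v) then restrict M f e else 0ℤ)
                        ≡ (if not (M e) ∧ isYes (end e ≟ v) then f e else 0ℤ)
      pointwise e with M e
      ... | true  = refl
      ... | false = refl

  flow⇒kirchhoff : ∀ M f → (∀ e → M e ≡ true → f e ≡ 0ℤ) → IsFlow f →
                   ∀ v → outflow G M f v ≡ inflow G M f v
  flow⇒kirchhoff M f f≡0 flow v =
    ℤP.i-j≡0⇒i≡j _ _ (trans (sym (netflow≡outflow−inflow M f f≡0 v)) (flow v))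

  deg-disjoint : ∀ {S T} → (∀ e → T e ≡ true → S e ≡ false) →
                 ∀ v → deg S v + deg T v ≤ deg (λ _ → true) v
  deg-disjoint {S} {T} disjoint v =
    subst (_≤ deg (λ _ → true) v) (sumℕ-distrib-+ (bitAt S) (bitAt T)) (sumℕ-mono-≤ pointwise)
    where
    bitAt : EdgeSet G → Fin m → ℕ
    bitAt X e = bit (X e ∧ incident G e v)
    pointwise : ∀ e → bitAt S e + bitAt T e ≤ bit (incident G e v)
    pointwise e with T e in Te | incident G e v
    ... | true  | true  rewrite disjoint e Te = ℕP.≤-refl
    ... | true  | false rewrite BP.∧-zeroʳ (S e) = z≤n
    ... | false | b     rewrite ℕP.+-identityʳ (bit (S e ∧ b)) with S e
    ...   | true  = ℕP.≤-refl
    ...   | false = z≤n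

  doubleCover-degree-sum : ∀ {l} {F : Fin l → EdgeSet G} → (∀ e → count (λ j → F j e) ≡ 2) →
                           ∀ v → sumℕ (λ j → deg (F j) v) ≡ deg (λ _ → true) v + deg (λ _ → true) v
  doubleCover-degree-sum {F = F} twice v = begin
    sumℕ (λ j → sumℕ (λ e → bit (F j e ∧ incident G e v)))
      ≡⟨ sumℕ-comm (λ j e → bit (F j e ∧ incident G e v)) ⟩
    sumℕ (λ e → count (λ j → F j e ∧ incident G e v))        ≡⟨ sumℕ-cong pointwise ⟩
    sumℕ (λ e → bit (incident G e v) + bit (incident G e v))
      ≡⟨ sumℕ-distrib-+ (λ e → bit (incident G e v)) (λ e → bit (incident G e v)) ⟩
    deg (λ _ → true) v + deg (λ _ → true) v              ∎
    where
    open ≡-Reasoning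
    pointwise : ∀ e → count (λ j → F j e ∧ incident G e v) ≡ bit (incident G e v) + bit (incident G e v)
    pointwise e with incident G e v
    ... | true  = trans (count-∧ (λ j → F j e) true) (twice e)
    ... | false = count-∧ (λ j → F j e) false

  MaxDegree≤2 : EdgeSet G → Set
  MaxDegree≤2 S = ∀ v → deg S v ≤ 2

  -- The invariant maintained while a subgraph of maximum degree 2 is oriented edge by edge.
  record PathOrientation (S : EdgeSet G) (φ : Fin m → ℤ) : Set where
    field
      unit-on      : ∀ e → S e ≡ true → IsUnit (φ e)
      zero-off     : ∀ e → S e ≡ false → φ e ≡ 0ℤ
      unit-at-ends : ∀ v → deg S v ≡ 1 → IsUnit (netflow φ v)
      balanced     : ∀ v → deg S v ≢ 1 → netflow φ v ≡ 0ℤ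

  addAt : Fin m → ℤ → (Fin m → ℤ) → Fin m → ℤ
  addAt e s φ e' = φ e' ℤ.+ δ e e' ℤ.* s

  netflow-addAt : ∀ e s φ w → netflow (addAt e s φ) w ≡ netflow φ w ℤ.+ incidence w e ℤ.* s
  netflow-addAt e s φ w =
    trans (netflow-+ φ (λ e' → δ e e' ℤ.* s) w) (cong (ℤ._+_ (netflow φ w)) (netflow-δ e s w))

  netflow-addAt-away : ∀ {e w} s φ → incident G e w ≡ false → netflow (addAt e s φ) w ≡ netflow φ w
  netflow-addAt-away {e} {w} s φ inc rewrite netflow-addAt e s φ w | incidence-nonincident inc = ℤP.+-identityʳ _

  extend-pathOrientation : ∀ {S φ e s} → S e ≡ true → MaxDegree≤2 S → IsUnit s →
    PathOrientation (remove e S) φ →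
    (∀ w → incident G e w ≡ true → deg S w ≡ 2 → netflow φ w ℤ.+ incidence w e ℤ.* s ≡ 0ℤ) →
    PathOrientation S (addAt e s φ)
  extend-pathOrientation {S} {φ} {e} {s} Se maxDeg unit-s o closes = record
    { unit-on = unit-on ; zero-off = zero-off ; unit-at-ends = unit-at-ends ; balanced = balanced }
    where
    module O = PathOrientation o
    removed : ∀ {e'} → e ≢ e' → remove e S e' ≡ S e'
    removed {e'} e≢e' rewrite dec-false (e ≟ e') e≢e' = refl
    φe≡0 : φ e ≡ 0ℤ
    φe≡0 = O.zero-off e (cong (λ b → if b then false else S e) (dec-true (e ≟ e) refl))
    unit-on : ∀ e' → S e' ≡ true → IsUnit (addAt e s φ e')
    unit-on e' Se' with e ≟ e'
    ... | yes refl rewrite φe≡0 | ℤP.*-identityˡ s = subst IsUnit (sym (ℤP.+-identityˡ s)) unit-s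
    ... | no e≢e' rewrite ℤP.+-identityʳ (φ e') = O.unit-on e' (trans (removed e≢e') Se')
    zero-off : ∀ e' → S e' ≡ false → addAt e s φ e' ≡ 0ℤ
    zero-off e' Se' with e ≟ e'
    ... | yes refl with () ← trans (sym Se) Se'
    ... | no e≢e' = trans (ℤP.+-identityʳ (φ e')) (O.zero-off e' (trans (removed e≢e') Se'))
    degS : ∀ {w b} → incident G e w ≡ b → deg S w ≡ deg (remove e S) w + bit b
    degS = deg-remove Se
    unit-at-ends : ∀ w → deg S w ≡ 1 → IsUnit (netflow (addAt e s φ) w)
    unit-at-ends w d≡1 with incident G e w in inc
    ... | true  rewrite netflow-addAt e s φ w
                      | O.balanced w (λ d'≡1 →
                          ℕP.1+n≢n (sym (trans (sym d≡1) (trans (degS inc) (cong (_+ 1) d'≡1)))))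
                      = subst IsUnit (sym (ℤP.+-identityˡ _)) (IsUnit-* (incidence-unit inc) unit-s)
    ... | false rewrite netflow-addAt-away s φ inc =
                  O.unit-at-ends w (trans (sym (ℕP.+-identityʳ _)) (trans (sym (degS inc)) d≡1))
    balanced : ∀ w → deg S w ≢ 1 → netflow (addAt e s φ) w ≡ 0ℤ
    balanced w d≢1 with incident G e w in inc
    ... | true  = trans (netflow-addAt e s φ w)
                        (closes w inc (degS≡2 (deg (remove e S) w) (degS inc) (maxDeg w)))
      where
      degS≡2 : ∀ d → deg S w ≡ d + 1 → deg S w ≤ 2 → deg S w ≡ 2
      degS≡2 0       d≡1 _ = ⊥-elim (d≢1 d≡1)
      degS≡2 1       d≡2 _ = d≡2
      degS≡2 (suc (suc d)) d≡ d≤2 =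
        ⊥-elim (ℕP.<⇒≱ (subst (3 ℕ.≤_) (sym d≡) (s≤s (s≤s (ℕP.m≤n+m 1 d)))) d≤2)
    ... | false rewrite netflow-addAt-away s φ inc =
                  O.balanced w (λ d'≡1 → d≢1 (trans (degS inc) (trans (ℕP.+-identityʳ _) d'≡1)))

  -- When both ends of e have degree 2, the sign given to e has to balance the netflow at both of them.
  EndsCancel : EdgeSet G → Fin m → Set
  EndsCancel S e = deg S (tail e) ≡ 2 → deg S (head e) ≡ 2 →
    ∀ φ → PathOrientation (remove e S) φ → netflow φ (tail e) ℤ.+ netflow φ (head e) ≡ 0ℤ

  removed-end-unit : ∀ {S e φ w} → S e ≡ true → PathOrientation (remove e S) φ →
                     incident G e w ≡ true → deg S w ≡ 2 → IsUnit (netflow φ w)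
  removed-end-unit Se o inc d≡2 =
    PathOrientation.unit-at-ends o _ (ℕP.+-cancelʳ-≡ 1 _ 1 (trans (sym (deg-remove Se inc)) d≡2))

  orient-by-removing : ∀ {S e} → S e ≡ true → MaxDegree≤2 S → EndsCancel S e →
                       ∃ (PathOrientation (remove e S)) → ∃ (PathOrientation S)
  orient-by-removing {S} {e} Se maxDeg cancel (φ , o)
    with balancingSign (deg S (tail e) ℕ.≟ 2) (deg S (head e) ℕ.≟ 2) (netflow φ (tail e)) (netflow φ (head e))
                       (removed-end-unit Se o (incident-tail e)) (removed-end-unit Se o (incident-head e))
                       (λ t≡2 h≡2 → cancel t≡2 h≡2 φ o)
  ... | s , unit-s , closesTail , closesHead = addAt e s φ , extend-pathOrientation Se maxDeg unit-s o closes
    where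
    closes : ∀ w → incident G e w ≡ true → deg S w ≡ 2 → netflow φ w ℤ.+ incidence w e ℤ.* s ≡ 0ℤ
    closes w inc d≡2 with incident⇒endpoint inc
    ... | inj₁ refl rewrite incidence-tail e = closesTail d≡2
    ... | inj₂ refl rewrite incidence-head e = closesHead d≡2

  EndsOfDegree2 : EdgeSet G → Set
  EndsOfDegree2 S = ∀ e → S e ≡ true → deg S (tail e) ≡ 2 × deg S (head e) ≡ 2

  endsOfDegree2⇒deg≢1 : ∀ {S} → EndsOfDegree2 S → ∀ w → deg S w ≢ 1
  endsOfDegree2⇒deg≢1 {S} ends w d≡1
    with e , Se∧inc ← count≢0⇒true (λ e → S e ∧ incident G e w) (ℕP.1+n≢0 ∘ trans (sym d≡1))
    with Se , inc ← ∧≡true Se∧inc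
    with incident⇒endpoint {e} {w} inc
  ... | inj₁ refl = ℕP.1+n≢n (trans (sym (proj₁ (ends e Se))) d≡1)
  ... | inj₂ refl = ℕP.1+n≢n (trans (sym (proj₂ (ends e Se))) d≡1)

  -- Removing an edge from a circuit leaves a path; the total netflow vanishes and only its two ends contribute.
  endsOfDegree2⇒endsCancel : ∀ {S e} → EndsOfDegree2 S → S e ≡ true → EndsCancel S e
  endsOfDegree2⇒endsCancel {S} {e} ends Se _ _ φ o =
    trans (sym (sum-pair (netflow φ) (loopless e) vanish)) (netflow-total φ)
    where
    vanish : ∀ w → w ≢ tail e → w ≢ head e → netflow φ w ≡ 0ℤ
    vanish w w≢t w≢h = PathOrientation.balanced o w λ d'≡1 →
      endsOfDegree2⇒deg≢1 ends w
        (trans (deg-remove Se (nonendpoint⇒nonincident w≢t w≢h)) (trans (ℕP.+-identityʳ _) d'≡1))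

  orient-step : ∀ {k S} → count S ≡ suc k → MaxDegree≤2 S →
                (∀ {S'} → count S' ≡ k → MaxDegree≤2 S' → ∃ (PathOrientation S')) →
                ∃ (PathOrientation S)
  orient-step {k} {S} count≡ maxDeg orient = byCases (any? pathEnd?)
    where
    ends2? : ∀ e → Dec (deg S (tail e) ≡ 2 × deg S (head e) ≡ 2)
    ends2? e = (deg S (tail e) ℕ.≟ 2) ×-dec (deg S (head e) ℕ.≟ 2)
    pathEnd? : ∀ e → Dec (S e ≡ true × ¬ (deg S (tail e) ≡ 2 × deg S (head e) ≡ 2))
    pathEnd? e = (S e B.≟ true) ×-dec ¬? (ends2? e)
    byRemoving : ∀ {e} → S e ≡ true → EndsCancel S e → ∃ (PathOrientation S)
    byRemoving {e} Se cancel = orient-by-removing Se maxDeg cancel (orient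
      (ℕP.suc-injective (trans (sym (count-remove S e Se)) count≡))
      (λ v → ℕP.≤-trans (deg-mono (remove-⊆ {S} {e}) v) (maxDeg v)))
    byCases : Dec (∃ λ e → S e ≡ true × ¬ (deg S (tail e) ≡ 2 × deg S (head e) ≡ 2)) →
              ∃ (PathOrientation S)
    byCases (yes (e , Se , ¬ends2)) = byRemoving Se (λ t≡2 h≡2 → ⊥-elim (¬ends2 (t≡2 , h≡2)))
    byCases (no ¬pathEnd)
      with e , Se ← count≢0⇒true S (λ count≡0 → ℕP.1+n≢0 (trans (sym count≡) count≡0))
      = byRemoving Se (endsOfDegree2⇒endsCancel ends Se)
      where
      ends : EndsOfDegree2 S
      ends e Se = decidable-stable (ends2? e) (λ ¬ends2 → ¬pathEnd (e , Se , ¬ends2))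

  pathOrientation : ∀ k {S} → count S ≡ k → MaxDegree≤2 S → ∃ (PathOrientation S)
  pathOrientation zero {S} count≡0 _ = (λ _ → 0ℤ) , record
    { unit-on      = λ e Se → ⊥-elim (BP.not-¬ Se (count≡0⇒false S count≡0 e))
    ; zero-off     = λ _ _ → refl
    ; unit-at-ends = λ v d≡1 → ⊥-elim (nonempty v d≡1)
    ; balanced     = λ v _ → sum-zero (λ e → ℤP.*-zeroʳ (incidence v e))
    }
    where
    nonempty : ∀ v → deg S v ≢ 1
    nonempty v d≡1
      with e , Se∧inc ← count≢0⇒true (λ e → S e ∧ incident G e v) (ℕP.1+n≢0 ∘ trans (sym d≡1))
      = BP.not-¬ (proj₁ (∧≡true Se∧inc)) (count≡0⇒false S count≡0 e)
  pathOrientation (suc k) count≡ maxDeg = orient-step count≡ maxDeg (pathOrientation k)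

  record UnitFlow (S : EdgeSet G) (φ : Fin m → ℤ) : Set where
    field
      unit-on  : ∀ e → S e ≡ true → IsUnit (φ e)
      zero-off : ∀ e → S e ≡ false → φ e ≡ 0ℤ
      flow     : IsFlow φ

  twoRegular⇒maxDegree≤2 : ∀ {S} → TwoRegular G S → MaxDegree≤2 S
  twoRegular⇒maxDegree≤2 twoReg v with twoReg v
  ... | inj₁ d≡0 rewrite d≡0 = z≤n
  ... | inj₂ d≡2 rewrite d≡2 = ℕP.≤-refl

  twoRegular⇒deg≢1 : ∀ {S} → TwoRegular G S → ∀ v → deg S v ≢ 1
  twoRegular⇒deg≢1 twoReg v d≡1 with twoReg v
  ... | inj₁ d≡0 = ℕP.1+n≢0 (trans (sym d≡1) d≡0)
  ... | inj₂ d≡2 = ℕP.1+n≢n (trans (sym d≡2) d≡1)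

  twoRegular⇒unitFlow : ∀ {S} → TwoRegular G S → ∃ (UnitFlow S)
  twoRegular⇒unitFlow {S} twoReg with φ , o ← pathOrientation _ refl (twoRegular⇒maxDegree≤2 twoReg) =
    φ , record { unit-on  = O.unit-on
               ; zero-off = O.zero-off
               ; flow     = λ v → O.balanced v (twoRegular⇒deg≢1 twoReg v) }
    where module O = PathOrientation o

  unitFlow-oddSupport : ∀ {S φ} → UnitFlow S φ → ∀ e → oddSupport φ e ≡ S e
  unitFlow-oddSupport {S} {φ} u e with S e in Se
  ... | true  rewrite parityℤ-unit (UnitFlow.unit-on u e Se) = refl
  ... | false rewrite UnitFlow.zero-off u e Se = refl

  record EvenCover (M : EdgeSet G) : Set where
    field
      D₁ D₂  : EdgeSet G
      even₁  : Even D₁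
      even₂  : Even D₂
      avoids : ∀ e → M e ≡ true → D₁ e ≡ false × D₂ e ≡ false
      covers : ∀ e → M e ≡ false → D₁ e ∨ D₂ e ≡ true

  fiveCDC-outside : ∀ {F} → Is5CDC G F → ∀ e → F 0F e ∧ F 1F e ≡ true →
                    F 2F e ≡ false × F 3F e ≡ false × F 4F e ≡ false
  fiveCDC-outside {F} (_ , twice) e = doubly-covered-outside (F 0F e) (F 1F e) (F 2F e) (F 3F e) (F 4F e) (twice e)

  fiveCDC⇒evenCover : ∀ {F} → Is5CDC G F → EvenCover (λ e → F 0F e ∧ F 1F e)
  fiveCDC⇒evenCover {F} cdc@(twoReg , twice) = record
    { D₁     = λ e → F 2F e xor F 3F e
    ; D₂     = λ e → F 3F e xor F 4F e
    ; even₁  = even-xor (twoRegular⇒even (twoReg 2F)) (twoRegular⇒even (twoReg 3F))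
    ; even₂  = even-xor (twoRegular⇒even (twoReg 3F)) (twoRegular⇒even (twoReg 4F))
    ; avoids = λ e onM → let F₂≡ , F₃≡ , F₄≡ = fiveCDC-outside cdc e onM
                         in cong₂ _xor_ F₂≡ F₃≡ , cong₂ _xor_ F₃≡ F₄≡
    ; covers = λ e → differences-cover (F 0F e) (F 1F e) (F 2F e) (F 3F e) (F 4F e) (twice e)
    }

  fiveCDC⇒matching : Cubic G → ∀ {F} → Is5CDC G F → Matching G (λ e → F 0F e ∧ F 1F e)
  fiveCDC⇒matching cubic {F} cdc@(twoReg , twice) v =
    matching-degree (twoReg 0F v) (twoReg 1F v) (twoReg 2F v) (twoReg 3F v) (twoReg 4F v)
      (trans (doubleCover-degree-sum {F = F} twice v) (cong₂ _+_ (cubic v) (cubic v)))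
      (bound (λ e → proj₁ ∘ fiveCDC-outside cdc e))
      (bound (λ e → proj₁ ∘ proj₂ ∘ fiveCDC-outside cdc e))
      (bound (λ e → proj₂ ∘ proj₂ ∘ fiveCDC-outside cdc e))
    where
    M : EdgeSet G
    M e = F 0F e ∧ F 1F e
    bound : ∀ {X} → (∀ e → M e ≡ true → X e ≡ false) → deg X v + deg M v ≤ 3
    bound {X} disjoint = subst (deg X v + deg M v ≤_) (cubic v) (deg-disjoint disjoint v)

  transpose-5CDC : ∀ {F} → Is5CDC G F → (i : Fin 5) → Is5CDC G (λ j → F (transpose 0F i ⟨$⟩ʳ j))
  transpose-5CDC {F} (twoReg , twice) i =
    (λ j → twoReg _) , (λ e → trans (count-permute (λ j → F j e) (transpose 0F i)) (twice e))

  half-flow : ∀ {f φ} → IsFlow f → UnitFlow (oddSupport f) φ → IsFlow (λ e → half (f e ℤ.- φ e))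
  half-flow {f} {φ} flow u v = x+x≡0⇒x≡0 _ (begin
    netflow g v ℤ.+ netflow g v                   ≡⟨ netflow-+ g g v ⟨
    netflow (λ e → g e ℤ.+ g e) v                 ≡⟨ netflow-cong g+g v ⟩
    netflow (λ e → f e ℤ.- φ e) v                 ≡⟨ netflow-+ f (λ e → ℤ.- φ e) v ⟩
    netflow f v ℤ.+ netflow (λ e → ℤ.- φ e) v     ≡⟨ cong (ℤ._+_ (netflow f v)) (netflow-neg φ v) ⟩
    netflow f v ℤ.- netflow φ v                   ≡⟨ cong₂ ℤ._-_ (flow v) (UnitFlow.flow u v) ⟩
    0ℤ                                            ∎)
    where
    open ≡-Reasoning
    g : Fin m → ℤ
    g e = half (f e ℤ.- φ e)
    g+g : ∀ e → g e ℤ.+ g e ≡ f e ℤ.- φ e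
    g+g e = half+half _ (begin
      parityℤ (f e ℤ.- φ e)             ≡⟨ parityℤ-homo-− (f e) (φ e) ⟩
      parityℤ (f e) ℙ.+ parityℤ (φ e)   ≡⟨ cong (parityℤ (f e) ℙ.+_) (isOdd-injective (unitFlow-oddSupport u e)) ⟩
      parityℤ (f e) ℙ.+ parityℤ (f e)   ≡⟨ ℙP.p+p≡0ℙ (parityℤ (f e)) ⟩
      0ℙ                                ∎)

  module _ (cubic : Cubic G) where

    even⇒unitFlow : ∀ {S} → Even S → ∃ (UnitFlow S)
    even⇒unitFlow = twoRegular⇒unitFlow ∘ even⇒twoRegular cubic

    evenCover⇒nz4Flow : ∀ {M} → EvenCover M → HasNZ4FlowAfterDeleting G M
    evenCover⇒nz4Flow {M} cover
      with φ₁ , u₁ ← even⇒unitFlow (EvenCover.even₁ cover)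
      with φ₂ , u₂ ← even⇒unitFlow (EvenCover.even₂ cover)
      = f , nowhereZero , flow⇒kirchhoff M f zeroOnM flowF
      where
      open EvenCover cover
      f : Fin m → ℤ
      f e = φ₁ e ℤ.+ (φ₂ e ℤ.+ φ₂ e)
      nowhereZero : ∀ e → M e ≡ false → 0 < ℤ.∣ f e ∣ × ℤ.∣ f e ∣ < 4
      nowhereZero e offM = x+2y-nowhere-zero (D₁ e) (D₂ e)
        (UnitFlow.unit-on u₁ e) (UnitFlow.zero-off u₁ e) (UnitFlow.unit-on u₂ e) (UnitFlow.zero-off u₂ e)
        (covers e offM)
      zeroOnM : ∀ e → M e ≡ true → f e ≡ 0ℤ
      zeroOnM e onM rewrite UnitFlow.zero-off u₁ e (proj₁ (avoids e onM))
                          | UnitFlow.zero-off u₂ e (proj₂ (avoids e onM)) = refl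
      flowF : IsFlow f
      flowF v = begin
        netflow f v                                          ≡⟨ netflow-+ φ₁ _ v ⟩
        netflow φ₁ v ℤ.+ netflow (λ e → φ₂ e ℤ.+ φ₂ e) v
          ≡⟨ cong (ℤ._+_ (netflow φ₁ v)) (netflow-+ φ₂ φ₂ v) ⟩
        netflow φ₁ v ℤ.+ (netflow φ₂ v ℤ.+ netflow φ₂ v)
          ≡⟨ cong₂ (λ a b → a ℤ.+ (b ℤ.+ b)) (UnitFlow.flow u₁ v) (UnitFlow.flow u₂ v) ⟩
        0ℤ                                                   ∎
        where open ≡-Reasoning

    nz4Flow⇒evenCover : ∀ {M} → HasNZ4FlowAfterDeleting G M → EvenCover M
    nz4Flow⇒evenCover {M} (f , nowhereZero , kirchhoff)
      with φ₁ , u₁ ← even⇒unitFlow (flow⇒even-oddSupport (kirchhoff⇒flow M f kirchhoff))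
      = record
      { D₁     = oddSupport f'
      ; D₂     = oddSupport g
      ; even₁  = flow⇒even-oddSupport flow'
      ; even₂  = flow⇒even-oddSupport (half-flow flow' u₁)
      ; avoids = avoids
      ; covers = covers
      }
      where
      f' = restrict M f
      flow' : IsFlow f'
      flow' = kirchhoff⇒flow M f kirchhoff
      g : Fin m → ℤ
      g e = half (f' e ℤ.- φ₁ e)
      avoids : ∀ e → M e ≡ true → oddSupport f' e ≡ false × oddSupport g e ≡ false
      avoids e onM rewrite restrict-zero M f e onM
                         | UnitFlow.zero-off u₁ e (cong (isOdd ∘ parityℤ) (restrict-zero M f e onM)) = refl , refl
      covers : ∀ e → M e ≡ false → oddSupport f' e ∨ oddSupport g e ≡ true
      covers e offM with oddSupport f' e in f'e-odd
      ... | true  = refl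
      ... | false rewrite UnitFlow.zero-off u₁ e f'e-odd | ℤP.+-identityʳ (f' e) | restrict-off M f e offM =
        let 0<∣fe∣ , ∣fe∣<4 = nowhereZero e offM
        in cong isOdd (half-odd (f e) 0<∣fe∣ ∣fe∣<4 (isOdd-injective f'e-odd))

    evenCover⇒5CDC : ∀ {M C₁ C₂} → EvenCover M → TwoRegular G C₁ → TwoRegular G C₂ →
                     (∀ e → M e ≡ (C₁ e ∧ C₂ e)) →
                     ∃ λ F → Is5CDC G F × F 0F ≡ C₁
    evenCover⇒5CDC {M} {C₁} {C₂} cover twoC₁ twoC₂ M≡C₁∩C₂ = F , (twoReg , twice) , refl
      where
      open EvenCover cover
      X : EdgeSet G
      X e = C₁ e xor C₂ e
      evenX : Even X
      evenX = even-xor (twoRegular⇒even twoC₁) (twoRegular⇒even twoC₂)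
      F : Fin 5 → EdgeSet G
      F 0F = C₁
      F 1F = C₂
      F 2F = λ e → D₁ e xor X e
      F 3F = λ e → D₂ e xor X e
      F 4F = λ e → (D₁ e xor D₂ e) xor X e
      twoReg : ∀ i → TwoRegular G (F i)
      twoReg 0F = twoC₁
      twoReg 1F = twoC₂
      twoReg 2F = even⇒twoRegular cubic (even-xor even₁ evenX)
      twoReg 3F = even⇒twoRegular cubic (even-xor even₂ evenX)
      twoReg 4F = even⇒twoRegular cubic (even-xor (even-xor even₁ even₂) evenX)
      twice : ∀ e → count (λ i → F i e) ≡ 2
      twice e = five-cover (C₁ e) (C₂ e) (D₁ e) (D₂ e) (λ onM → avoids e (trans (M≡C₁∩C₂ e) onM))
                           (λ offM → covers e (trans (M≡C₁∩C₂ e) offM))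

theorem1 : (G : Graph) → Cubic G → (C0 : EdgeSet G) → TwoRegular G C0 →
    Has5CDCContaining G C0 ⇔ MatchingCondition G C0
theorem1 G cubic C0 _ = mk⇔ forward backward
  where
  forward : Has5CDCContaining G C0 → MatchingCondition G C0
  forward (F , cdc , i , C0⊆Fᵢ) =
    M , fiveCDC⇒matching G cubic cdc′ , evenCover⇒nz4Flow G cubic (fiveCDC⇒evenCover G cdc′) ,
    F′ 0F , F′ 1F , proj₁ cdc′ 0F , proj₁ cdc′ 1F , (λ _ → refl) , C0⊆Fᵢ
    where
    F′ = λ j → F (transpose 0F i ⟨$⟩ʳ j)
    cdc′ = transpose-5CDC G cdc i
    M : EdgeSet G
    M e = F′ 0F e ∧ F′ 1F e
  backward : MatchingCondition G C0 → Has5CDCContaining G C0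
  backward (M , _ , nz4Flow , C₁ , C₂ , twoC₁ , twoC₂ , M≡C₁∩C₂ , C0⊆C₁)
    with F , cdc , F₀≡C₁ ←
           evenCover⇒5CDC G cubic (nz4Flow⇒evenCover G cubic nz4Flow) twoC₁ twoC₂ M≡C₁∩C₂
    =
    F , cdc , 0F , subst (_⊆E_ G C0) (sym F₀≡C₁) C0⊆C₁
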